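{- Let $G$ be an interval colorable graph and $n\in\mathbb{N}$. Then $G[\overline{K_n}]$ is interval colorable, and $w(G[\overline{K_n}])\le w(G)\cdot n$ and $W(G[\overline{K_n}])\ge W(G)\cdot n$.
   Context: All graphs are finite, undirected, without loops or multiple edges. $\overline{K_n}$ is the edgeless graph on $n$ vertices. A proper edge-coloring with consecutive integers $c_1,\ldots,c_t$ is an interval $t$-coloring if all $t$ colors are used and the set of colors on edges incident to each vertex is an interval of integers. A graph is interval colorable if it has an interval $t$-coloring for some positive integer $t$; $w(G)$ and $W(G)$ denote the smallest and largest such $t$. The composition $G[H]$ has vertex set $V(G)\times V(H)$, with $(u_1,v_1)(u_2,v_2)$ an edge iff $u_1u_2\in E(G)$, or $u_1=u_2$ and $v_1v_2\in E(H)$. -}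

module Defs where

open import Data.Nat using (ℕ; zero; suc; _+_; _*_; _≤_; _<_)
open import Data.Fin using (Fin)
open import Data.Bool using (Bool; true; false)
open import Data.Product using (Σ; _×_; _,_; ∃; ∃-syntax)
open import Relation.Binary.PropositionalEquality using (_≡_)
open import Relation.Nullary using (¬_)

record Graph : Set where
  field
    v     : ℕ
    adj   : Fin v → Fin v → Bool
    sym   : ∀ x y → adj x y ≡ adj y x
    irrefl : ∀ x → adj x x ≡ false
open Graph public

Edge : (G : Graph) → Fin (v G) → Fin (v G) → Set
Edge G x y = adj G x y ≡ true

record IntervalColoring (G : Graph) (t : ℕ) : Set where
  field
    col      : (x y : Fin (v G)) → Edge G x y → ℕ
    -- the colour depends only on the (undirected) edge
    col-sym  : ∀ x y (p : Edge G x y) (q : Edge G y x) → col x y p ≡ col y x q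
    col-irr  : ∀ x y (p q : Edge G x y) → col x y p ≡ col x y q
    range    : ∀ x y (p : Edge G x y) → 1 ≤ col x y p × col x y p ≤ t
    proper   : ∀ x y z (p : Edge G x y) (q : Edge G x z) →
               col x y p ≡ col x z q → y ≡ z
    surj     : ∀ k → 1 ≤ k → k ≤ t → ∃[ x ] ∃[ y ] Σ (Edge G x y) λ p → col x y p ≡ k
    interval : ∀ x y z (p : Edge G x y) (q : Edge G x z) k →
               col x y p ≤ k → k ≤ col x z q →
               ∃[ u ] Σ (Edge G x u) λ r → col x u r ≡ k
open IntervalColoring public

IntervalColorable : Graph → Set
IntervalColorable G = Σ ℕ λ t → 1 ≤ t × IntervalColoring G t

-- Composition G[ \overline{K_n} ]: vertices (u , i) ∈ Fin v × Fin n, encoded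
-- via Fin (v * n); (u₁,i₁)(u₂,i₂) is an edge iff u₁u₂ ∈ E(G).
open import Data.Fin using (combine; remQuot)
open import Data.Product using (proj₁)

compEmpty : Graph → ℕ → Graph
compEmpty G n = record
  { v = v G * n
  ; adj = λ a b → adj G (proj₁ (remQuot {v G} n a)) (proj₁ (remQuot {v G} n b))
  ; sym = λ a b → sym G (proj₁ (remQuot {v G} n a)) (proj₁ (remQuot {v G} n b))
  ; irrefl = λ a → irrefl G (proj₁ (remQuot {v G} n a))
  }

module Submission where

-- Write a vertex of G[K̄ₙ] as (u , i) with u a vertex of G and i < n.  Given an
-- interval t-colouring c of G, colour the edge (u , i)(w , j) with
--
--     (c(uw) - 1)·n + ((i + j) mod n) + 1 ,
--
-- i.e. the colour c(uw) of G is refined into the block of n consecutive colours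
-- (c(uw) - 1)·n + 1, …, c(uw)·n, and inside the block the offset is the cyclic
-- sum i + j.  Since j ↦ (i + j) mod n is a bijection of ℤ/n, the n copies of an
-- edge uw at a fixed vertex (u , i) use each colour of the block exactly once;
-- hence the colouring is proper, uses all t·n colours, and at every vertex the
-- colours form a union of consecutive blocks, i.e. an interval.
--
-- The corollary takes s = t·n, which
-- witnesses both w(G[K̄ₙ]) ≤ w(G)·n and W(G[K̄ₙ]) ≥ W(G)·n.

open import Defs hiding (sym)
open import Data.Nat
  using (ℕ; suc; pred; _+_; _*_; _∸_; _≤_; _<_; z≤n; s≤s; NonZero; >-nonZero; >-nonZero⁻¹)
open import Data.Nat.Properties
open import Data.Nat.DivMod
open import Data.Nat.Divisibility using (n∣m*n)
open import Algebra.Properties.CommutativeSemigroup +-commutativeSemigroup using (x∙yz≈y∙xz)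
open import Data.Fin using (Fin; toℕ; fromℕ<; combine; remQuot)
open import Data.Fin.Properties using (toℕ<n; toℕ-fromℕ<; toℕ-injective; remQuot-combine; combine-remQuot)
open import Data.Product using (Σ; _×_; _,_; proj₁; proj₂; uncurry)
open import Relation.Binary.PropositionalEquality
  using (_≡_; refl; sym; trans; cong; cong₂; module ≡-Reasoning)

module Cyclic (n : ℕ) .{{_ : NonZero n}} where
  open ≡-Reasoning

  unshift : ∀ {x} y → x ≤ n → ((n ∸ x) + (x + y)) % n ≡ y % n
  unshift {x} y x≤n = begin
    ((n ∸ x) + (x + y)) % n  ≡⟨ cong (_% n) (sym (+-assoc (n ∸ x) x y)) ⟩
    ((n ∸ x + x) + y) % n    ≡⟨ cong (λ m → (m + y) % n) (m∸n+n≡m x≤n) ⟩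
    (n + y) % n              ≡⟨ cong (_% n) (+-comm n y) ⟩
    (y + n) % n              ≡⟨ [m+n]%n≡m%n y n ⟩
    y % n                    ∎

  +-%-absorbʳ : ∀ x m → (x + m % n) % n ≡ (x + m) % n
  +-%-absorbʳ x m = begin
    (x + m % n) % n          ≡⟨ %-distribˡ-+ x (m % n) n ⟩
    (x % n + m % n % n) % n  ≡⟨ cong (λ k → (x % n + k) % n) (m%n%n≡m%n m n) ⟩
    (x % n + m % n) % n      ≡⟨ %-distribˡ-+ x m n ⟨
    (x + m) % n              ∎

  shift-injective : ∀ {x} y z → x ≤ n → (x + y) % n ≡ (x + z) % n → y % n ≡ z % n
  shift-injective {x} y z x≤n eq = begin
    y % n                          ≡⟨ unshift y x≤n ⟨
    ((n ∸ x) + (x + y)) % n        ≡⟨ +-%-absorbʳ (n ∸ x) (x + y) ⟨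
    ((n ∸ x) + (x + y) % n) % n    ≡⟨ cong (λ k → ((n ∸ x) + k) % n) eq ⟩
    ((n ∸ x) + (x + z) % n) % n    ≡⟨ +-%-absorbʳ (n ∸ x) (x + z) ⟩
    ((n ∸ x) + (x + z)) % n        ≡⟨ unshift z x≤n ⟩
    z % n                          ∎

  shift-surjective : ∀ {x} r → x ≤ n → (x + ((n ∸ x) + r) % n) % n ≡ r % n
  shift-surjective {x} r x≤n = begin
    (x + ((n ∸ x) + r) % n) % n  ≡⟨ +-%-absorbʳ x ((n ∸ x) + r) ⟩
    (x + ((n ∸ x) + r)) % n      ≡⟨ cong (_% n) (x∙yz≈y∙xz x (n ∸ x) r) ⟩
    ((n ∸ x) + (x + r)) % n      ≡⟨ unshift r x≤n ⟩
    r % n                        ∎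

module Digits (n : ℕ) .{{_ : NonZero n}} where

  rem-digits : ∀ {r} a → r < n → (r + a * n) % n ≡ r
  rem-digits {r} a r<n = trans ([m+kn]%n≡m%n r a n) (m<n⇒m%n≡m r<n)

  quot-digits : ∀ {r} a → r < n → (r + a * n) / n ≡ a
  quot-digits {r} a r<n = begin
    (r + a * n) / n    ≡⟨ +-distrib-/-∣ʳ r (n∣m*n a) ⟩
    r / n + a * n / n  ≡⟨ cong₂ _+_ (m<n⇒m/n≡0 r<n) (m*n/n≡m a n) ⟩
    a                  ∎
    where open ≡-Reasoning

  digits-injective : ∀ {r s} a b → r < n → s < n → r + a * n ≡ s + b * n → r ≡ s × a ≡ b
  digits-injective {r} {s} a b r<n s<n eq =
      trans (sym (rem-digits a r<n)) (trans (cong (_% n) eq) (rem-digits b s<n))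
    , trans (sym (quot-digits a r<n)) (trans (cong (_/ n) eq) (quot-digits b s<n))

  quot-≥ : ∀ {r} a {k} → r + a * n ≤ k → a ≤ k / n
  quot-≥ {r} a {k} le = begin
    a                ≡⟨ m*n/n≡m a n ⟨
    a * n / n        ≤⟨ /-monoˡ-≤ n (≤-trans (m≤n+m (a * n) r) le) ⟩
    k / n            ∎
    where open ≤-Reasoning

  quot-≤ : ∀ {r} b {k} → r < n → k ≤ r + b * n → k / n ≤ b
  quot-≤ {r} b {k} r<n le = ≤-trans (/-monoˡ-≤ n le) (≤-reflexive (quot-digits b r<n))

  digits-bound : ∀ {r a} t → r < n → a < t → suc (r + a * n) ≤ t * n
  digits-bound {r} {a} t r<n a<t = begin
    suc r + a * n   ≤⟨ +-monoˡ-≤ (a * n) r<n ⟩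
    n + a * n       ≡⟨⟩
    suc a * n       ≤⟨ *-monoˡ-≤ n a<t ⟩
    t * n           ∎
    where open ≤-Reasoning

module Coordinates (G : Graph) (n : ℕ) where

  Vertex : Set
  Vertex = Fin (v (compEmpty G n))

  base : Vertex → Fin (v G)
  base a = proj₁ (remQuot {v G} n a)

  layer : Vertex → ℕ
  layer a = toℕ (proj₂ (remQuot {v G} n a))

  layer<n : ∀ a → layer a < n
  layer<n a = toℕ<n (proj₂ (remQuot {v G} n a))

  vertex : Fin (v G) → Fin n → Vertex
  vertex = combine

  base-vertex : ∀ u j → base (vertex u j) ≡ u
  base-vertex u j = cong proj₁ (remQuot-combine u j)

  layer-vertex : ∀ u j → layer (vertex u j) ≡ toℕ j
  layer-vertex u j = cong (λ c → toℕ (proj₂ c)) (remQuot-combine u j)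

  coordinates-injective : ∀ {a b} → base a ≡ base b → layer a ≡ layer b → a ≡ b
  coordinates-injective {a} {b} base≡ layer≡ = begin
    a                                    ≡⟨ combine-remQuot {v G} n a ⟨
    uncurry combine (remQuot {v G} n a)  ≡⟨ cong (uncurry combine) (cong₂ _,_ base≡ (toℕ-injective layer≡)) ⟩
    uncurry combine (remQuot {v G} n b)  ≡⟨ combine-remQuot {v G} n b ⟩
    b                                    ∎
    where open ≡-Reasoning

module BlowUp (G : Graph) (n : ℕ) .{{_ : NonZero n}} {t : ℕ} (C : IntervalColoring G t) where
  open Coordinates G n
  open Cyclic n
  open Digits n

  H : Graph
  H = compEmpty G n

  offset : Vertex → Vertex → ℕ
  offset a b = (layer a + layer b) % n

  offset<n : ∀ a b → offset a b < n
  offset<n a b = m%n<n (layer a + layer b) n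

  block : ∀ u w → Edge G u w → ℕ
  block u w p = pred (col C u w p)

  suc-block : ∀ u w (p : Edge G u w) → suc (block u w p) ≡ col C u w p
  suc-block u w p = suc-pred (col C u w p) {{>-nonZero (proj₁ (range C u w p))}}

  block<t : ∀ u w (p : Edge G u w) → block u w p < t
  block<t u w p = ≤-trans (≤-reflexive (suc-block u w p)) (proj₂ (range C u w p))

  same-block⇒same-col : ∀ {u w w'} (p : Edge G u w) (q : Edge G u w') →
                    block u w p ≡ block u w' q → col C u w p ≡ col C u w' q
  same-block⇒same-col {u} {w} {w'} p q eq =
    trans (sym (suc-block u w p)) (trans (cong suc eq) (suc-block u w' q))

  lift-edge : ∀ a b {u w} → base a ≡ u → base b ≡ w → (p : Edge G u w) →
              Σ (Edge H a b) λ e → block (base a) (base b) e ≡ block u w p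
  lift-edge a b refl refl p = p , refl

  colour : (a b : Vertex) → Edge H a b → ℕ
  colour a b e = suc (offset a b + block (base a) (base b) e * n)

  -- The layer j with (layer a + j) mod n = r, by surjectivity of translation.
  partner-layer : Vertex → ℕ → Fin n
  partner-layer a r = fromℕ< (m%n<n ((n ∸ layer a) + r) n)

  realise : ∀ a {u w} → base a ≡ u → (p : Edge G u w) → ∀ r → r < n →
            Σ Vertex λ b → Σ (Edge H a b) λ e → colour a b e ≡ suc (r + block u w p * n)
  realise a {u} {w} base≡ p r r<n
    with e , block≡ ← lift-edge a (vertex w (partner-layer a r)) base≡ (base-vertex w _) p
    = _ , e , cong suc (cong₂ (λ o d → o + d * n) offset≡ block≡)
    where
      j : Fin n
      j = partner-layer a r
      offset≡ : offset a (vertex w j) ≡ r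
      offset≡ = begin
        (layer a + layer (vertex w j)) % n         ≡⟨ cong (λ l → (layer a + l) % n) (trans (layer-vertex w j) (toℕ-fromℕ< _)) ⟩
        (layer a + ((n ∸ layer a) + r) % n) % n    ≡⟨ shift-surjective r (<⇒≤ (layer<n a)) ⟩
        r % n                                      ≡⟨ m<n⇒m%n≡m r<n ⟩
        r                                          ∎
        where open ≡-Reasoning

  realise-colour : ∀ a {u w} → base a ≡ u → (p : Edge G u w) → ∀ k → col C u w p ≡ suc (k / n) →
                   Σ Vertex λ b → Σ (Edge H a b) λ e → colour a b e ≡ suc k
  realise-colour a {u} {w} base≡ p k col≡
    with b , e , colour≡ ← realise a base≡ p (k % n) (m%n<n k n)
    = b , e , trans colour≡ (cong suc digits)
    where
      digits : k % n + block u w p * n ≡ k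
      digits = trans (cong (λ c → k % n + pred c * n) col≡) (sym (m≡m%n+[m/n]*n k n))

  colour-range : ∀ a b (e : Edge H a b) → 1 ≤ colour a b e × colour a b e ≤ t * n
  colour-range a b e = s≤s z≤n , digits-bound t (offset<n a b) (block<t (base a) (base b) e)

  colour-proper : ∀ a b b' (e : Edge H a b) (e' : Edge H a b') → colour a b e ≡ colour a b' e' → b ≡ b'
  colour-proper a b b' e e' eq = coordinates-injective base≡ layer≡
    where
      digits≡ : offset a b ≡ offset a b' × block (base a) (base b) e ≡ block (base a) (base b') e'
      digits≡ = digits-injective _ _ (offset<n a b) (offset<n a b') (suc-injective eq)
      base≡ : base b ≡ base b'
      base≡ = proper C (base a) (base b) (base b') e e' (same-block⇒same-col e e' (proj₂ digits≡))
      layer≡ : layer b ≡ layer b'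
      layer≡ = trans (sym (m<n⇒m%n≡m (layer<n b)))
                 (trans (shift-injective (layer b) (layer b') (<⇒≤ (layer<n a)) (proj₁ digits≡))
                        (m<n⇒m%n≡m (layer<n b')))

  -- Every colour 1 + k ≤ t·n has block k / n, which C uses on some edge uw;
  -- its offset k % n is realised above that edge.
  colour-surjective : ∀ k → 1 ≤ k → k ≤ t * n →
                      Σ Vertex λ a → Σ Vertex λ b → Σ (Edge H a b) λ e → colour a b e ≡ k
  colour-surjective (suc k) _ k<tn
    with u , w , p , col≡ ← surj C (suc (k / n)) (s≤s z≤n) (m<n*o⇒m/o<n k<tn)
    = vertex u layer₀ , realise-colour (vertex u layer₀) (base-vertex u layer₀) p k col≡
    where
      layer₀ : Fin n
      layer₀ = fromℕ< (>-nonZero⁻¹ n)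

  col-below : ∀ u w (p : Edge G u w) {r k} → r + block u w p * n ≤ k → col C u w p ≤ suc (k / n)
  col-below u w p le = ≤-trans (≤-reflexive (sym (suc-block u w p))) (s≤s (quot-≥ (block u w p) le))

  col-above : ∀ u w (p : Edge G u w) {r k} → r < n → k ≤ r + block u w p * n → suc (k / n) ≤ col C u w p
  col-above u w p r<n le = ≤-trans (s≤s (quot-≤ (block u w p) r<n le)) (≤-reflexive (suc-block u w p))

  -- A colour 1 + k between two colours at a has block k / n between their
  -- blocks; by the interval property of C that block occurs at base a, and
  -- the offset k % n is realised above it.
  colour-interval : ∀ a b b' (e : Edge H a b) (e' : Edge H a b') k →
                    colour a b e ≤ k → k ≤ colour a b' e' →
                    Σ Vertex λ c → Σ (Edge H a c) λ f → colour a c f ≡ k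
  colour-interval a b b' e e' (suc k) (s≤s lo) (s≤s hi)
    with w , p , col≡ ← interval C (base a) (base b) (base b') e e' (suc (k / n))
                           (col-below (base a) (base b) e lo) (col-above (base a) (base b') e' (offset<n a b') hi)
    = realise-colour a refl p k col≡

  colouring : IntervalColoring H (t * n)
  colouring = record
    { col      = colour
    ; col-sym  = λ a b e e' → cong suc (cong₂ (λ o d → o + pred d * n)
                   (cong (_% n) (+-comm (layer a) (layer b))) (col-sym C (base a) (base b) e e'))
    ; col-irr  = λ a b e e' → cong (λ d → suc (offset a b + pred d * n)) (col-irr C (base a) (base b) e e')
    ; range    = colour-range
    ; proper   = colour-proper
    ; surj     = colour-surjective
    ; interval = colour-interval
    }

blow-up : ∀ G n → 1 ≤ n → ∀ {t} → IntervalColoring G t → IntervalColoring (compEmpty G n) (t * n)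
blow-up G n 1≤n C = BlowUp.colouring G n {{>-nonZero 1≤n}} C

corollary2 : (G : Graph) → IntervalColorable G → (n : ℕ) → 1 ≤ n →
    IntervalColorable (compEmpty G n)
    × ((t : ℕ) → 1 ≤ t → IntervalColoring G t →
         Σ ℕ λ s → 1 ≤ s × IntervalColoring (compEmpty G n) s × s ≤ t * n)
    × ((t : ℕ) → 1 ≤ t → IntervalColoring G t →
         Σ ℕ λ s → 1 ≤ s × IntervalColoring (compEmpty G n) s × t * n ≤ s)
corollary2 G (t₀ , 1≤t₀ , C₀) n 1≤n =
    (t₀ * n , *-mono-≤ 1≤t₀ 1≤n , blow-up G n 1≤n C₀)
  , (λ t 1≤t C → t * n , *-mono-≤ 1≤t 1≤n , blow-up G n 1≤n C , ≤-refl)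
  , (λ t 1≤t C → t * n , *-mono-≤ 1≤t 1≤n , blow-up G n 1≤n C , ≤-refl)
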